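{- If $G$ is a finite simple graph containing no theta and no wheel as an induced subgraph, and $G$ has a star cutset, then $G$ has a clique cutset.
   Context: A star cutset is a set $S$ of nodes such that $G\setminus S$ is disconnected and $S$ contains a node adjacent to all other nodes of $S$. A clique cutset is a set of nodes inducing a clique (possibly empty) whose removal disconnects the graph. A hole is a chordless cycle of length at least 4; a wheel is a hole $H$ plus a node $c\notin V(H)$ with at least three neighbors in $H$. A theta consists of three internally node-disjoint chordless paths between two nodes $a,b$, each of length at least 2, with no edges between the paths other than the three edges at $a$ and the three edges at $b$. -}

module Defs where

open import Data.Nat using (ℕ; zero; suc; _≤_; _∸_)
open import Data.Fin using (Fin; toℕ; fromℕ)
open import Data.Fin.Subset using (Subset; _∈_; _∉_)
open import Data.Product using (Σ; ∃; ∃-syntax; _×_; _,_)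
open import Data.Sum using (_⊎_)
open import Relation.Nullary using (¬_; Dec)
open import Relation.Binary.PropositionalEquality using (_≡_; _≢_)
open import Function.Definitions using (Injective)
open import Function.Bundles using (_⇔_)

record Graph (n : ℕ) : Set₁ where
  field
    E      : Fin n → Fin n → Set
    sym    : ∀ {u v} → E u v → E v u
    irrefl : ∀ {u} → ¬ E u u
    dec    : ∀ u v → Dec (E u v)
open Graph public

module _ {n : ℕ} (G : Graph n) where

  -- v is reachable from u by a path in G \ S (u itself assumed outside S).
  data Reach (S : Subset n) : Fin n → Fin n → Set where
    here : ∀ {u} → Reach S u u
    step : ∀ {u w v} → E G u w → w ∉ S → Reach S w v → Reach S u v

  Disconnected : Subset n → Set
  Disconnected S = ∃[ u ] ∃[ v ] (u ∉ S × v ∉ S × ¬ Reach S u v)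

  IsCutset : Subset n → Set
  IsCutset S = Disconnected S

  IsStarCutset : Subset n → Set
  IsStarCutset S = IsCutset S × (∃[ x ] (x ∈ S × (∀ y → y ∈ S → y ≢ x → E G x y)))

  IsCliqueCutset : Subset n → Set
  IsCliqueCutset S = IsCutset S × (∀ x y → x ∈ S → y ∈ S → x ≢ y → E G x y)

  HasStarCutset : Set
  HasStarCutset = ∃[ S ] IsStarCutset S

  HasCliqueCutset : Set
  HasCliqueCutset = ∃[ S ] IsCliqueCutset S

  PathAdj : ∀ {m} → Fin m → Fin m → Set
  PathAdj i j = toℕ j ≡ suc (toℕ i) ⊎ toℕ i ≡ suc (toℕ j)

  CycAdj : ∀ {m} → Fin m → Fin m → Set
  CycAdj {m} i j = PathAdj i j
                 ⊎ (toℕ i ≡ m ∸ 1 × toℕ j ≡ 0)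
                 ⊎ (toℕ j ≡ m ∸ 1 × toℕ i ≡ 0)

  IsChordlessPath : ∀ {k} → (Fin (suc k) → Fin n) → Set
  IsChordlessPath p = Injective _≡_ _≡_ p × (∀ i j → E G (p i) (p j) ⇔ PathAdj i j)

  IsHole : ∀ {m} → (Fin m → Fin n) → Set
  IsHole {m} h = 4 ≤ m × Injective _≡_ _≡_ h × (∀ i j → E G (h i) (h j) ⇔ CycAdj i j)

  Interior : ∀ {k} → Fin (suc k) → Set
  Interior {k} i = ¬ (toℕ i ≡ 0) × ¬ (toℕ i ≡ k)

  record Theta : Set where
    field
      a b    : Fin n
      len    : Fin 3 → ℕ
      path   : (r : Fin 3) → Fin (suc (len r)) → Fin n
      len≥2  : ∀ r → 2 ≤ len r
      chordless : ∀ r → IsChordlessPath (path r)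
      start  : ∀ r → path r Data.Fin.zero ≡ a
      end    : ∀ r → path r (fromℕ (len r)) ≡ b
      disjoint : ∀ r s → r ≢ s → ∀ i j → Interior i → Interior j →
                 path r i ≢ path s j × ¬ E G (path r i) (path s j)

  record Wheel : Set where
    field
      m      : ℕ
      hole   : Fin m → Fin n
      isHole : IsHole hole
      c      : Fin n
      c∉H    : ∀ i → hole i ≢ c
      i₁ i₂ i₃ : Fin m
      distinct : i₁ ≢ i₂ × i₁ ≢ i₃ × i₂ ≢ i₃
      adj    : E G c (hole i₁) × E G c (hole i₂) × E G c (hole i₃)

-- Let S be a star cutset with centre x separating u from v, let T₁ ⊆ S be the vertices with a
-- neighbour in the component C of u in G ∖ S, and T₂ ⊆ T₁ those with a neighbour in the component D
-- of v in G ∖ T₁; T₂ still separates u from v. If x ∉ D and T₂ is not a clique, two non-adjacent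
-- a, b ∈ T₂ are joined by chordless paths through C and through D, which together form a hole. Since
-- x is adjacent to a and b, it yields a wheel if it has a neighbour inside the hole, and otherwise a
-- theta with the path a–x–b. If x ∈ D, the same argument applies to the star cutset T₁ ∪ {x} with
-- the roles of u and v exchanged.

module Submission where

open import Defs
open import Data.Nat as ℕ using (ℕ; zero; suc; _≤_; _<_; _∸_; _+_; z≤n; s≤s; z<s; _≤?_)
import Data.Nat.Properties as ℕ
open import Data.Nat.Induction using (<-wellFounded)
open import Data.Fin using (Fin; zero; suc; toℕ; fromℕ<)
import Data.Fin.Properties as Fin
open import Data.Fin.Subset using (Subset; _∈_; _∉_; _⊆_; _∪_; ⁅_⁆; ∣_∣)
open import Data.Fin.Subset.Properties
  using (_∈?_; x∈⁅x⁆; x∈⁅y⁆⇒x≡y; x∈p∪q⁻; p⊆p∪q; q⊆p∪q; p⊂q⇒∣p∣<∣q∣; ∣p∣≤n)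
open import Data.Vec using (tabulate)
open import Data.Vec.Properties using (lookup∘tabulate; []=⇒lookup; lookup⇒[]=)
open import Data.Product using (Σ; ∃; ∃-syntax; _×_; _,_; proj₁; proj₂)
open import Data.Sum using (_⊎_; inj₁; inj₂; [_,_]′; reduce)
open import Data.Empty using (⊥-elim)
open import Function using (_∘_; id)
open import Induction.WellFounded using (Acc; acc)
open import Relation.Binary.Definitions using (tri<; tri≈; tri>)
open import Relation.Nullary using (¬_; Dec; yes; no; does; contradiction)
open import Relation.Nullary.Decidable using (_×-dec_; _⊎-dec_; ¬?; map′; dec-true; decidable-stable)
open import Relation.Binary.PropositionalEquality
  using (_≡_; _≢_; refl; cong; subst; subst₂) renaming (sym to ≡-sym; trans to ≡-trans)
open import Function.Bundles using (mk⇔)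

module _ {m : ℕ} {P : Fin m → Set} (P? : ∀ i → Dec (P i)) where

  comprehension : Subset m
  comprehension = tabulate (λ i → does (P? i))

  ∈-comprehension⁺ : ∀ {i} → P i → i ∈ comprehension
  ∈-comprehension⁺ {i} p = lookup⇒[]= i _ (≡-trans (lookup∘tabulate _ i) (dec-true (P? i) p))

  ∈-comprehension⁻ : ∀ {i} → i ∈ comprehension → P i
  ∈-comprehension⁻ {i} i∈ with P? i | ≡-trans (≡-sym (lookup∘tabulate _ i)) ([]=⇒lookup i∈)
  ... | yes p | _ = p
  ... | no _ | ()

∣p∣<∣p∪⁅x⁆∣ : ∀ {n} {p : Subset n} {x} → x ∉ p → ∣ p ∣ < ∣ p ∪ ⁅ x ⁆ ∣
∣p∣<∣p∪⁅x⁆∣ {p = p} {x} x∉p = p⊂q⇒∣p∣<∣q∣ (p⊆p∪q ⁅ x ⁆ , x , q⊆p∪q p ⁅ x ⁆ (x∈⁅x⁆ x) , x∉p)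

+-balance : ∀ {i s j s′} → i + s ≡ j + s′ → s ≡ s′ → i ≡ j
+-balance {i} {s} {j} eq refl = ℕ.+-cancelʳ-≡ s i j eq

+-balance-suc : ∀ {i s j s′} → i + s ≡ j + s′ → s′ ≡ suc s → i ≡ suc j
+-balance-suc {i} {s} {j} eq refl = ℕ.+-cancelʳ-≡ s i (suc j) (≡-trans eq (ℕ.+-suc j s))

+-balance-suc′ : ∀ {i s j s′} → i + s ≡ j + s′ → j ≡ suc i → s ≡ suc s′
+-balance-suc′ {i} {s} {s′ = s′} eq refl = ℕ.+-cancelˡ-≡ i s (suc s′) (≡-trans eq (≡-sym (ℕ.+-suc i s′)))

CycAdjℕ : ℕ → ℕ → ℕ → Set
CycAdjℕ m i j = (j ≡ suc i ⊎ i ≡ suc j) ⊎ (i ≡ m ∸ 1 × j ≡ 0) ⊎ (j ≡ m ∸ 1 × i ≡ 0)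

CycAdjℕ-sym : ∀ {m i j} → CycAdjℕ m i j → CycAdjℕ m j i
CycAdjℕ-sym (inj₁ (inj₁ j≡i+1)) = inj₁ (inj₂ j≡i+1)
CycAdjℕ-sym (inj₁ (inj₂ i≡j+1)) = inj₁ (inj₁ i≡j+1)
CycAdjℕ-sym (inj₂ (inj₁ wrap)) = inj₂ (inj₂ wrap)
CycAdjℕ-sym (inj₂ (inj₂ wrap)) = inj₂ (inj₁ wrap)

module _ {n : ℕ} (G : Graph n) where

  Reach-∉ : ∀ {T u v} → Reach G T u v → u ∉ T → v ∉ T
  Reach-∉ here u∉ = u∉
  Reach-∉ (step _ w∉ r) _ = Reach-∉ r w∉

  Reach-snoc : ∀ {T u w v} → Reach G T u w → E G w v → v ∉ T → Reach G T u v
  Reach-snoc here e v∉ = step e v∉ here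
  Reach-snoc (step e′ w∉ r) e v∉ = step e′ w∉ (Reach-snoc r e v∉)

  Reach-trans : ∀ {T u w v} → Reach G T u w → Reach G T w v → Reach G T u v
  Reach-trans here r = r
  Reach-trans (step e w∉ r) r′ = step e w∉ (Reach-trans r r′)

  Reach-reverse : ∀ {T u v} → u ∉ T → Reach G T u v → Reach G T v u
  Reach-reverse _ here = here
  Reach-reverse u∉ (step e w∉ r) = Reach-snoc (Reach-reverse w∉ r) (sym G e) u∉

  Reach-antimono : ∀ {T T′ u v} → T ⊆ T′ → Reach G T′ u v → Reach G T u v
  Reach-antimono T⊆T′ here = here
  Reach-antimono T⊆T′ (step e w∉ r) = step e (w∉ ∘ T⊆T′) (Reach-antimono T⊆T′ r)

  ∉-∪⁅⁆ : ∀ {T : Subset n} {z w} → z ∉ T → z ≢ w → z ∉ T ∪ ⁅ w ⁆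
  ∉-∪⁅⁆ {T} {w = w} z∉ z≢w z∈ = [ z∉ , z≢w ∘ x∈⁅y⁆⇒x≡y w ]′ (x∈p∪q⁻ T ⁅ w ⁆ z∈)

  -- Either the walk never returns to z, or its suffix after the last visit to z is a walk from z.
  Reach-avoid : ∀ {T u v} z → Reach G T u v → Reach G (T ∪ ⁅ z ⁆) u v ⊎ Reach G (T ∪ ⁅ z ⁆) z v
  Reach-avoid z here = inj₁ here
  Reach-avoid z (step {w = w} e w∉ r) with Reach-avoid z r | w Fin.≟ z
  ... | inj₂ r′ | _ = inj₂ r′
  ... | inj₁ r′ | yes refl = inj₂ r′
  ... | inj₁ r′ | no w≢z = inj₁ (step e (∉-∪⁅⁆ w∉ w≢z) r′)

  Reach-avoid-start : ∀ {T u v} → Reach G T u v → Reach G (T ∪ ⁅ u ⁆) u v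
  Reach-avoid-start {u = u} r = reduce (Reach-avoid u r)

  Reach? : ∀ T u v → Dec (Reach G T u v)
  Reach? T₀ u₀ v = go T₀ (<-wellFounded (n ∸ ∣ T₀ ∣)) u₀
    where
      shrinks : ∀ {T w} → w ∉ T → n ∸ ∣ T ∪ ⁅ w ⁆ ∣ < n ∸ ∣ T ∣
      shrinks {T} {w} w∉ = ℕ.∸-monoʳ-< (∣p∣<∣p∪⁅x⁆∣ w∉) (∣p∣≤n (T ∪ ⁅ w ⁆))

      go : ∀ T → Acc _<_ (n ∸ ∣ T ∣) → ∀ u → Dec (Reach G T u v)
      go T (acc rs) u with u Fin.≟ v
      ... | yes refl = yes here
      ... | no u≢v = map′ (λ (w , e , w∉ , r) → step e w∉ (Reach-antimono (p⊆p∪q ⁅ w ⁆) r))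
                          (λ { here → contradiction refl u≢v
                             ; (step {w = w} e w∉ r) → w , e , w∉ , Reach-avoid-start r })
                          (Fin.any? next?)
        where
          next? : ∀ w → Dec (E G u w × w ∉ T × Reach G (T ∪ ⁅ w ⁆) w v)
          next? w with w ∈? T
          ... | yes w∈ = no (λ (_ , w∉ , _) → w∉ w∈)
          ... | no w∉ = dec G u w ×-dec (yes w∉ ×-dec go (T ∪ ⁅ w ⁆) (rs (shrinks w∉)) w)

  neighbour-≢ : ∀ {x z} → E G x z → z ≢ x
  neighbour-≢ e refl = irrefl G e

  record Walk (P : Fin n → Set) (a b : Fin n) : Set where
    field
      len      : ℕ
      vertex   : ℕ → Fin n
      start    : vertex 0 ≡ a
      end      : vertex len ≡ b
      adjacent : ∀ t → t < len → E G (vertex t) (vertex (suc t))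
      interior : ∀ t → 0 < t → t < len → P (vertex t)
  open Walk

  edge-walk : ∀ {P a b} → E G a b → Walk P a b
  edge-walk {a = a} {b} e = record
    { len = 1 ; vertex = λ { 0 → a ; _ → b } ; start = refl ; end = refl
    ; adjacent = λ { 0 _ → e ; (suc _) (s≤s ()) }
    ; interior = λ { (suc _) _ (s≤s ()) } }

  cons-walk : ∀ {P a w b} → E G a w → P w → Walk P w b → Walk P a b
  cons-walk {P} {a} e pw W = record
    { len = suc (len W)
    ; vertex = λ { 0 → a ; (suc t) → vertex W t }
    ; start = refl ; end = end W
    ; adjacent = λ { 0 _ → subst (E G a) (≡-sym (start W)) e
                   ; (suc t) (s≤s t<) → adjacent W t t< }
    ; interior = λ { (suc 0) _ _ → subst P (≡-sym (start W)) pw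
                   ; (suc (suc t)) _ (s≤s t<) → interior W (suc t) z<s t< } }

  restrict-walk : ∀ {P Q a b} (W : Walk P a b) → (∀ t → 0 < t → t < len W → Q (vertex W t)) → Walk Q a b
  restrict-walk W Q-interior = record
    { len = len W ; vertex = vertex W ; start = start W ; end = end W
    ; adjacent = adjacent W ; interior = Q-interior }

  Chordless : ∀ {P a b} → Walk P a b → Set
  Chordless W = ∀ i j → i ≤ len W → j ≤ len W →
                (vertex W i ≡ vertex W j → i ≡ j) ×
                (E G (vertex W i) (vertex W j) → j ≡ suc i ⊎ i ≡ suc j)

  Shorter : ∀ {P a b} → Walk P a b → Set
  Shorter {P} {a} {b} W = Σ (Walk P a b) λ W′ → len W′ < len W

  truncate : ∀ {P a b} (W : Walk P a b) i → i < len W → vertex W i ≡ b → Shorter W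
  truncate W i i< eq = record
    { len = i ; vertex = vertex W ; start = start W ; end = eq
    ; adjacent = λ t t< → adjacent W t (ℕ.<-trans t< i<)
    ; interior = λ t 0< t< → interior W t 0< (ℕ.<-trans t< i<) } , i<

  -- Deletes the d vertices following position i.
  module Bypass {P a b} (W : Walk P a b) (i d ℓ : ℕ) (ℓ+d≡len : ℓ + d ≡ len W) (i<ℓ : i < ℓ)
                (jump : E G (vertex W i) (vertex W (suc i + d))) where

    shift< : ∀ {t} → t < ℓ → t + d < len W
    shift< {t} t<ℓ = subst (t + d <_) ℓ+d≡len (ℕ.+-monoˡ-< d t<ℓ)

    ℓ≤len : ℓ ≤ len W
    ℓ≤len = subst (ℓ ≤_) ℓ+d≡len (ℕ.m≤m+n ℓ d)

    pick : ∀ t → Dec (t ≤ i) → Fin n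
    pick t (yes _) = vertex W t
    pick t (no _) = vertex W (t + d)

    walk : Walk P a b
    walk = record
      { len = ℓ ; vertex = λ t → pick t (t ≤? i)
      ; start = start′ ; end = end′ ; adjacent = λ t → adjacent′ t (t ≤? i) (suc t ≤? i)
      ; interior = λ t → interior′ t (t ≤? i) }
      where
        start′ : pick 0 (0 ≤? i) ≡ a
        start′ with 0 ≤? i
        ... | yes _ = start W
        ... | no 0≰i = contradiction z≤n 0≰i

        end′ : pick ℓ (ℓ ≤? i) ≡ b
        end′ with ℓ ≤? i
        ... | yes ℓ≤i = contradiction ℓ≤i (ℕ.<⇒≱ i<ℓ)
        ... | no _ = ≡-trans (cong (vertex W) ℓ+d≡len) (end W)

        adjacent′ : ∀ t (d₁ : Dec (t ≤ i)) (d₂ : Dec (suc t ≤ i)) → t < ℓ →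
                    E G (pick t d₁) (pick (suc t) d₂)
        adjacent′ t (yes _) (yes t<i) _ = adjacent W t (ℕ.<-≤-trans t<i (ℕ.≤-trans (ℕ.<⇒≤ i<ℓ) ℓ≤len))
        adjacent′ t (yes t≤i) (no t≮i) _ rewrite ℕ.≤-antisym t≤i (ℕ.≮⇒≥ t≮i) = jump
        adjacent′ t (no t≰i) (yes t<i) _ = contradiction (ℕ.<⇒≤ t<i) t≰i
        adjacent′ t (no _) (no _) t<ℓ = adjacent W (t + d) (shift< t<ℓ)

        interior′ : ∀ t (d₁ : Dec (t ≤ i)) → 0 < t → t < ℓ → P (pick t d₁)
        interior′ t (yes t≤i) 0<t _ = interior W t 0<t (ℕ.≤-<-trans t≤i (ℕ.<-≤-trans i<ℓ ℓ≤len))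
        interior′ t (no _) 0<t t<ℓ = interior W (t + d) (ℕ.<-≤-trans 0<t (ℕ.m≤m+n t d)) (shift< t<ℓ)

  bypass : ∀ {P a b} (W : Walk P a b) i j → suc i < j → j ≤ len W →
           E G (vertex W i) (vertex W j) → Shorter W
  bypass W i j i+1<j j≤len e = Bypass.walk W i d ℓ ℓ+d≡len i<ℓ jump , ℓ<len
    where
      d ℓ : ℕ
      d = j ∸ suc i
      ℓ = len W ∸ d
      i+1+d≡j : suc i + d ≡ j
      i+1+d≡j = ℕ.m+[n∸m]≡n (ℕ.<⇒≤ i+1<j)
      ℓ+d≡len : ℓ + d ≡ len W
      ℓ+d≡len = ℕ.m∸n+n≡m (ℕ.≤-trans (ℕ.m∸n≤m j (suc i)) j≤len)
      i<ℓ : i < ℓ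
      i<ℓ = ℕ.m+n≤o⇒m≤o∸n (suc i) (subst (_≤ len W) (≡-sym i+1+d≡j) j≤len)
      jump : E G (vertex W i) (vertex W (suc i + d))
      jump = subst (λ k → E G (vertex W i) (vertex W k)) (≡-sym i+1+d≡j) e
      ℓ<len : ℓ < len W
      ℓ<len = subst (ℓ <_) ℓ+d≡len (ℕ.m<m+n ℓ (ℕ.m+n≤o⇒m≤o∸n 1 i+1<j))

  ShortcutAt : ∀ {P a b} → Walk P a b → ℕ → ℕ → Set
  ShortcutAt W i j = i < j × (vertex W i ≡ vertex W j ⊎ (suc i < j × E G (vertex W i) (vertex W j)))

  Shortcut : ∀ {P a b} → Walk P a b → Set
  Shortcut W = ∃ λ i → i < suc (len W) × ∃ λ j → j < suc (len W) × ShortcutAt W i j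

  shortcut? : ∀ {P a b} (W : Walk P a b) → Dec (Shortcut W)
  shortcut? W = ℕ.anyUpTo? (λ i → ℕ.anyUpTo? (λ j → at? i j) (suc (len W))) (suc (len W))
    where
      at? : ∀ i j → Dec (ShortcutAt W i j)
      at? i j = (i ℕ.<? j) ×-dec ((vertex W i Fin.≟ vertex W j) ⊎-dec ((suc i ℕ.<? j) ×-dec dec G _ _))

  ¬shortcut⇒chordless : ∀ {P a b} (W : Walk P a b) → ¬ Shortcut W → Chordless W
  ¬shortcut⇒chordless W ¬sc i j i≤ j≤ = injective , induced
    where
      ¬shortcutAt : ∀ {i j} → i ≤ len W → j ≤ len W → ¬ ShortcutAt W i j
      ¬shortcutAt {i} {j} i≤ j≤ s = ¬sc (i , s≤s i≤ , j , s≤s j≤ , s)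

      injective : vertex W i ≡ vertex W j → i ≡ j
      injective eq with ℕ.<-cmp i j
      ... | tri< i<j _ _ = contradiction (i<j , inj₁ eq) (¬shortcutAt i≤ j≤)
      ... | tri≈ _ i≡j _ = i≡j
      ... | tri> _ _ j<i = contradiction (j<i , inj₁ (≡-sym eq)) (¬shortcutAt j≤ i≤)

      induced : E G (vertex W i) (vertex W j) → j ≡ suc i ⊎ i ≡ suc j
      induced e with ℕ.<-cmp i j
      ... | tri≈ _ refl _ = contradiction e (irrefl G)
      ... | tri< i<j _ _ with ℕ.m≤n⇒m<n∨m≡n i<j
      ...   | inj₁ i+1<j = contradiction (i<j , inj₂ (i+1<j , e)) (¬shortcutAt i≤ j≤)
      ...   | inj₂ i+1≡j = inj₁ (≡-sym i+1≡j)
      induced e | tri> _ _ j<i with ℕ.m≤n⇒m<n∨m≡n j<i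
      ...   | inj₁ j+1<i = contradiction (j<i , inj₂ (j+1<i , sym G e)) (¬shortcutAt j≤ i≤)
      ...   | inj₂ j+1≡i = inj₂ (≡-sym j+1≡i)

  shortcut⇒shorter : ∀ {P a b} (W : Walk P a b) → Shortcut W → Shorter W
  shortcut⇒shorter W (i , _ , j , s≤s j≤len , i<j , inj₂ (i+1<j , e)) = bypass W i j i+1<j j≤len e
  shortcut⇒shorter W (i , _ , j , s≤s j≤len , i<j , inj₁ eq) with ℕ.m≤n⇒m<n∨m≡n j≤len
  ... | inj₁ j<len = bypass W i (suc j) (s≤s i<j) j<len
                       (subst (λ z → E G z (vertex W (suc j))) (≡-sym eq) (adjacent W j j<len))
  ... | inj₂ refl = truncate W i i<j (≡-trans eq (end W))

  chordless : ∀ {P a b} → Walk P a b → Σ (Walk P a b) Chordless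
  chordless W₀ = go W₀ (<-wellFounded (len W₀))
    where
      go : ∀ {P a b} (W : Walk P a b) → Acc _<_ (len W) → Σ (Walk P a b) Chordless
      go W (acc rs) with shortcut? W
      ... | no ¬sc = W , ¬shortcut⇒chordless W ¬sc
      ... | yes sc with shortcut⇒shorter W sc
      ...   | W′ , shorter = go W′ (rs shorter)

  len≥2 : ∀ {P a b} → a ≢ b → ¬ E G a b → (W : Walk P a b) → 2 ≤ len W
  len≥2 a≢b a≁b W with len W | end W | adjacent W
  ... | 0 | end₀ | _ = contradiction (≡-trans (≡-sym (start W)) end₀) a≢b
  ... | 1 | end₁ | adj = contradiction (subst₂ (E G) (start W) end₁ (adj 0 z<s)) a≁b
  ... | suc (suc _) | _ | _ = s≤s (s≤s z≤n)

  chordless⇒path : ∀ {P a b} (W : Walk P a b) → Chordless W →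
                   IsChordlessPath G {len W} (vertex W ∘ toℕ)
  chordless⇒path W ch = injective , λ i j → mk⇔ (chord i j) (consecutive i j)
    where
      ≤len : ∀ (i : Fin (suc (len W))) → toℕ i ≤ len W
      ≤len = Fin.toℕ≤pred[n]

      injective : ∀ {i j} → vertex W (toℕ i) ≡ vertex W (toℕ j) → i ≡ j
      injective {i} {j} eq = Fin.toℕ-injective (proj₁ (ch (toℕ i) (toℕ j) (≤len i) (≤len j)) eq)

      chord : ∀ i j → E G (vertex W (toℕ i)) (vertex W (toℕ j)) → PathAdj G i j
      chord i j = proj₂ (ch (toℕ i) (toℕ j) (≤len i) (≤len j))

      consecutive : ∀ i j → PathAdj G i j → E G (vertex W (toℕ i)) (vertex W (toℕ j))
      consecutive i j (inj₁ j≡i+1) = subst (λ k → E G (vertex W (toℕ i)) (vertex W k)) (≡-sym j≡i+1)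
                                       (adjacent W (toℕ i) (subst (_≤ len W) j≡i+1 (≤len j)))
      consecutive i j (inj₂ i≡j+1) = sym G (consecutive j i (inj₁ i≡j+1))

  Separated : (Fin n → Set) → (Fin n → Set) → Set
  Separated A B = ∀ {z y} → A z → B y → z ≢ y × ¬ E G z y

  Separated-sym : ∀ {A B} → Separated A B → Separated B A
  Separated-sym sep Ay Bz = let (z≢y , z≁y) = sep Bz Ay in z≢y ∘ ≡-sym , z≁y ∘ sym G

  Interior⇒bounds : ∀ {k} (i : Fin (suc k)) → Interior G i → 0 < toℕ i × toℕ i < k
  Interior⇒bounds i (i≢0 , i≢k) = ℕ.n≢0⇒n>0 i≢0 , ℕ.≤∧≢⇒< (Fin.toℕ≤pred[n] i) i≢k

  theta : ∀ {A₀ A₁ A₂ a b} → a ≢ b → ¬ E G a b →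
          Walk A₀ a b → Walk A₁ a b → Walk A₂ a b →
          Separated A₀ A₁ → Separated A₀ A₂ → Separated A₁ A₂ → Theta G
  theta {A₀} {A₁} {A₂} {a} {b} a≢b a≁b W₀ W₁ W₂ sep₀₁ sep₀₂ sep₁₂ = record
    { a = a ; b = b ; len = len ∘ path ; path = λ r → vertex (path r) ∘ toℕ
    ; len≥2 = len≥2 a≢b a≁b ∘ path
    ; chordless = λ r → chordless⇒path (path r) (proj₂ (chordless (walk r)))
    ; start = start ∘ path
    ; end = λ r → ≡-trans (cong (vertex (path r)) (Fin.toℕ-fromℕ (len (path r)))) (end (path r))
    ; disjoint = λ r s r≢s i j Ii Ij →
        let (0<i , i<) = Interior⇒bounds i Ii ; (0<j , j<) = Interior⇒bounds j Ij
        in separated r s r≢s (interior (path r) _ 0<i i<) (interior (path s) _ 0<j j<) }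
    where
      A : Fin 3 → Fin n → Set
      A zero = A₀
      A (suc zero) = A₁
      A (suc (suc zero)) = A₂

      walk : ∀ r → Walk (A r) a b
      walk zero = W₀
      walk (suc zero) = W₁
      walk (suc (suc zero)) = W₂

      path : ∀ r → Walk (A r) a b
      path r = proj₁ (chordless (walk r))

      separated : ∀ r s → r ≢ s → Separated (A r) (A s)
      separated zero zero r≢s = contradiction refl r≢s
      separated zero (suc zero) _ = sep₀₁
      separated zero (suc (suc zero)) _ = sep₀₂
      separated (suc zero) zero _ = Separated-sym sep₀₁
      separated (suc zero) (suc zero) r≢s = contradiction refl r≢s
      separated (suc zero) (suc (suc zero)) _ = sep₁₂
      separated (suc (suc zero)) zero _ = Separated-sym sep₀₂
      separated (suc (suc zero)) (suc zero) _ = Separated-sym sep₁₂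
      separated (suc (suc zero)) (suc (suc zero)) r≢s = contradiction refl r≢s

  -- The hole runs along P from a to b and back along Q: position t > k₁ holds the vertex of Q
  -- at index m ∸ t.
  module Hole {A B a b} (P : Walk A a b) (Q : Walk B a b) (chP : Chordless P) (chQ : Chordless Q)
              (sep : Separated A B) (a≢b : a ≢ b) (a≁b : ¬ E G a b) where

    k₁ k₂ m : ℕ
    k₁ = len P
    k₂ = len Q
    m = k₁ + k₂

    f g : ℕ → Fin n
    f = vertex P
    g = vertex Q

    hole : ℕ → Fin n
    hole t with t ≤? k₁
    ... | yes _ = f t
    ... | no _ = g (m ∸ t)

    k₁≥2 : 2 ≤ k₁
    k₁≥2 = len≥2 a≢b a≁b P

    k₂≥2 : 2 ≤ k₂
    k₂≥2 = len≥2 a≢b a≁b Q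

    f₀≡g₀ : f 0 ≡ g 0
    f₀≡g₀ = ≡-trans (start P) (≡-sym (start Q))

    fk₁≡gk₂ : f k₁ ≡ g k₂
    fk₁≡gk₂ = ≡-trans (end P) (≡-sym (end Q))

    0<k₁ : 0 < k₁
    0<k₁ = ℕ.<-≤-trans z<s k₁≥2

    k₁<m : k₁ < m
    k₁<m = ℕ.m<m+n k₁ (ℕ.<-≤-trans z<s k₂≥2)

    0<m : 0 < m
    0<m = ℕ.<-trans 0<k₁ k₁<m

    k₁<m∸1 : k₁ < m ∸ 1
    k₁<m∸1 = ℕ.m+n≤o⇒m≤o∸n (suc k₁) (subst (_≤ m) (ℕ.+-suc k₁ 1) (ℕ.+-monoʳ-≤ k₁ k₂≥2))

    k₁<complement : ∀ {t s} → s < k₂ → t + s ≡ m → k₁ < t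
    k₁<complement s<k₂ eq = ℕ.≰⇒> (λ t≤k₁ → ℕ.<⇒≢ (ℕ.+-mono-≤-< t≤k₁ s<k₂) eq)

    data Side (t : ℕ) : Set where
      onP : t ≤ k₁ → Side t
      onQ : ∀ {s} → 0 < s → s < k₂ → t + s ≡ m → Side t

    side : ∀ t → t < m → Side t
    side t t<m with t ≤? k₁
    ... | yes t≤k₁ = onP t≤k₁
    ... | no t≰k₁ = onQ (ℕ.m<n⇒0<n∸m t<m) (ℕ.+-cancelˡ-< k₁ (m ∸ t) k₂ k₁+s<m) t+s≡m
      where
        t+s≡m : t + (m ∸ t) ≡ m
        t+s≡m = ℕ.m+[n∸m]≡n (ℕ.<⇒≤ t<m)
        k₁+s<m : k₁ + (m ∸ t) < m
        k₁+s<m = subst (k₁ + (m ∸ t) <_) t+s≡m (ℕ.+-monoˡ-< (m ∸ t) (ℕ.≰⇒> t≰k₁))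

    hole-onP : ∀ {t} → t ≤ k₁ → hole t ≡ f t
    hole-onP {t} t≤k₁ with t ≤? k₁
    ... | yes _ = refl
    ... | no t≰k₁ = contradiction t≤k₁ t≰k₁

    hole-onQ : ∀ {t s} → s < k₂ → t + s ≡ m → hole t ≡ g s
    hole-onQ {t} {s} s<k₂ eq with t ≤? k₁
    ... | yes t≤k₁ = contradiction t≤k₁ (ℕ.<⇒≱ (k₁<complement s<k₂ eq))
    ... | no _ = cong g (≡-trans (cong (_∸ t) (≡-sym eq)) (ℕ.m+n∸m≡n t s))

    P-position : ∀ {i} → i ≤ k₁ → i ≡ 0 ⊎ i ≡ k₁ ⊎ (0 < i × i < k₁)
    P-position {zero} _ = inj₁ refl
    P-position {suc i} i≤k₁ = inj₂ ([ (λ i<k₁ → inj₂ (z<s , i<k₁)) , inj₁ ]′ (ℕ.m≤n⇒m<n∨m≡n i≤k₁))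

    mixed-≢ : ∀ {i s} → i ≤ k₁ → 0 < s → s < k₂ → f i ≢ g s
    mixed-≢ {i} {s} i≤k₁ 0<s s<k₂ eq with P-position i≤k₁
    ... | inj₁ refl = ℕ.<⇒≢ 0<s (proj₁ (chQ 0 s z≤n (ℕ.<⇒≤ s<k₂)) (≡-trans (≡-sym f₀≡g₀) eq))
    ... | inj₂ (inj₁ refl) =
      ℕ.<⇒≢ s<k₂ (≡-sym (proj₁ (chQ k₂ s ℕ.≤-refl (ℕ.<⇒≤ s<k₂)) (≡-trans (≡-sym fk₁≡gk₂) eq)))
    ... | inj₂ (inj₂ (0<i , i<k₁)) = proj₁ (sep (interior P i 0<i i<k₁) (interior Q s 0<s s<k₂)) eq

    mixed-E⇒adj : ∀ {i j s} → i ≤ k₁ → 0 < s → s < k₂ → j + s ≡ m → E G (f i) (g s) → CycAdjℕ m i j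
    mixed-E⇒adj {i} {j} {s} i≤k₁ 0<s s<k₂ eq e with P-position i≤k₁
    ... | inj₁ refl with proj₂ (chQ 0 s z≤n (ℕ.<⇒≤ s<k₂)) (subst (λ z → E G z (g s)) f₀≡g₀ e)
    ...   | inj₁ refl = inj₂ (inj₂ (≡-trans (≡-sym (ℕ.m+n∸n≡m j 1)) (cong (_∸ 1) eq) , refl))
    ...   | inj₂ ()
    mixed-E⇒adj {i} {j} {s} i≤k₁ 0<s s<k₂ eq e | inj₂ (inj₁ refl)
      with proj₂ (chQ k₂ s ℕ.≤-refl (ℕ.<⇒≤ s<k₂)) (subst (λ z → E G z (g s)) fk₁≡gk₂ e)
    ...   | inj₁ refl = contradiction s<k₂ (ℕ.<-asym (ℕ.n<1+n k₂))
    ...   | inj₂ k₂≡s+1 = inj₁ (inj₁ (+-balance-suc eq k₂≡s+1))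
    mixed-E⇒adj {i} {j} {s} i≤k₁ 0<s s<k₂ eq e | inj₂ (inj₂ (0<i , i<k₁)) =
      contradiction e (proj₂ (sep (interior P i 0<i i<k₁) (interior Q s 0<s s<k₂)))

    mixed-adj⇒E : ∀ {i j s} → i ≤ k₁ → 0 < s → s < k₂ → j + s ≡ m → CycAdjℕ m i j → E G (f i) (g s)
    mixed-adj⇒E {i} {j} {s} i≤k₁ 0<s s<k₂ eq (inj₁ (inj₁ refl))
      with ℕ.≤-antisym i≤k₁ (ℕ.≤-pred (k₁<complement s<k₂ eq))
    ... | refl = subst₂ (E G) (≡-trans (cong g (≡-sym k₂≡s+1)) (≡-sym fk₁≡gk₂)) refl
                   (sym G (adjacent Q s s<k₂))
      where
        k₂≡s+1 : k₂ ≡ suc s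
        k₂≡s+1 = +-balance-suc′ (≡-sym eq) refl
    mixed-adj⇒E i≤k₁ 0<s s<k₂ eq (inj₁ (inj₂ refl)) =
      contradiction (k₁<complement s<k₂ eq) (ℕ.<-asym i≤k₁)
    mixed-adj⇒E i≤k₁ 0<s s<k₂ eq (inj₂ (inj₁ (_ , refl))) = contradiction (k₁<complement s<k₂ eq) (λ ())
    mixed-adj⇒E {j = j} {s} i≤k₁ 0<s s<k₂ eq (inj₂ (inj₂ (refl , refl))) =
      subst₂ (E G) (≡-sym f₀≡g₀) (cong g (≡-sym s≡1)) (adjacent Q 0 (ℕ.<-trans 0<s s<k₂))
      where
        s≡1 : s ≡ 1
        s≡1 = ℕ.+-cancelˡ-≡ (m ∸ 1) s 1 (≡-trans eq (≡-sym (ℕ.m∸n+n≡m 0<m)))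

    hole-injective : ∀ i j → i < m → j < m → hole i ≡ hole j → i ≡ j
    hole-injective i j i<m j<m eq with side i i<m | side j j<m
    ... | onP p | onP q = proj₁ (chP i j p q) (subst₂ _≡_ (hole-onP p) (hole-onP q) eq)
    ... | onP p | onQ 0<s s< e =
      contradiction (subst₂ _≡_ (hole-onP p) (hole-onQ s< e) eq) (mixed-≢ p 0<s s<)
    ... | onQ 0<s s< e | onP q =
      contradiction (subst₂ _≡_ (hole-onP q) (hole-onQ s< e) (≡-sym eq)) (mixed-≢ q 0<s s<)
    ... | onQ _ s< e | onQ _ s′< e′ =
      +-balance (≡-trans e (≡-sym e′))
        (proj₁ (chQ _ _ (ℕ.<⇒≤ s<) (ℕ.<⇒≤ s′<)) (subst₂ _≡_ (hole-onQ s< e) (hole-onQ s′< e′) eq))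

    hole-E⇒adj : ∀ i j → i < m → j < m → E G (hole i) (hole j) → CycAdjℕ m i j
    hole-E⇒adj i j i<m j<m e with side i i<m | side j j<m
    ... | onP p | onP q = inj₁ (proj₂ (chP i j p q) (subst₂ (E G) (hole-onP p) (hole-onP q) e))
    ... | onP p | onQ 0<s s< eq = mixed-E⇒adj p 0<s s< eq (subst₂ (E G) (hole-onP p) (hole-onQ s< eq) e)
    ... | onQ 0<s s< eq | onP q =
      CycAdjℕ-sym {m} (mixed-E⇒adj q 0<s s< eq (subst₂ (E G) (hole-onP q) (hole-onQ s< eq) (sym G e)))
    ... | onQ _ s< eq | onQ _ s′< eq′
      with proj₂ (chQ _ _ (ℕ.<⇒≤ s<) (ℕ.<⇒≤ s′<)) (subst₂ (E G) (hole-onQ s< eq) (hole-onQ s′< eq′) e)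
    ...   | inj₁ s′≡s+1 = inj₁ (inj₂ (+-balance-suc (≡-trans eq (≡-sym eq′)) s′≡s+1))
    ...   | inj₂ s≡s′+1 = inj₁ (inj₁ (+-balance-suc (≡-trans eq′ (≡-sym eq)) s≡s′+1))

    hole-adj⇒E : ∀ i j → i < m → j < m → CycAdjℕ m i j → E G (hole i) (hole j)
    hole-adj⇒E i j i<m j<m c with side i i<m | side j j<m
    ... | onP p | onP q = subst₂ (E G) (≡-sym (hole-onP p)) (≡-sym (hole-onP q)) (along-P c)
      where
        along-P : CycAdjℕ m i j → E G (f i) (f j)
        along-P (inj₁ (inj₁ refl)) = adjacent P i q
        along-P (inj₁ (inj₂ refl)) = sym G (adjacent P j p)
        along-P (inj₂ (inj₁ (refl , _))) = contradiction p (ℕ.<⇒≱ k₁<m∸1)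
        along-P (inj₂ (inj₂ (refl , _))) = contradiction q (ℕ.<⇒≱ k₁<m∸1)
    ... | onP p | onQ 0<s s< eq =
      subst₂ (E G) (≡-sym (hole-onP p)) (≡-sym (hole-onQ s< eq)) (mixed-adj⇒E p 0<s s< eq c)
    ... | onQ 0<s s< eq | onP q =
      sym G (subst₂ (E G) (≡-sym (hole-onP q)) (≡-sym (hole-onQ s< eq))
                    (mixed-adj⇒E q 0<s s< eq (CycAdjℕ-sym {m} c)))
    ... | onQ {s} _ s< eq | onQ {s′} _ s′< eq′ =
      subst₂ (E G) (≡-sym (hole-onQ s< eq)) (≡-sym (hole-onQ s′< eq′)) (along-Q c)
      where
        along-Q : CycAdjℕ m i j → E G (g s) (g s′)
        along-Q (inj₁ (inj₁ j≡i+1)) with +-balance-suc′ (≡-trans eq (≡-sym eq′)) j≡i+1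
        ... | refl = sym G (adjacent Q s′ s′<)
        along-Q (inj₁ (inj₂ i≡j+1)) with +-balance-suc′ (≡-trans eq′ (≡-sym eq)) i≡j+1
        ... | refl = adjacent Q s s<
        along-Q (inj₂ (inj₁ (_ , refl))) = contradiction (k₁<complement s′< eq′) (λ ())
        along-Q (inj₂ (inj₂ (_ , refl))) = contradiction (k₁<complement s< eq) (λ ())

    isHole : IsHole G {m} (hole ∘ toℕ)
    isHole = ℕ.+-mono-≤ k₁≥2 k₂≥2
           , (λ {i} {j} → Fin.toℕ-injective ∘ hole-injective (toℕ i) (toℕ j) (Fin.toℕ<n i) (Fin.toℕ<n j))
           , λ i j → mk⇔ (hole-E⇒adj (toℕ i) (toℕ j) (Fin.toℕ<n i) (Fin.toℕ<n j))
                         (hole-adj⇒E (toℕ i) (toℕ j) (Fin.toℕ<n i) (Fin.toℕ<n j))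

    module Centre {x} (x∼a : E G x a) (x∼b : E G x b)
                  (A∌x : ∀ {z} → A z → z ≢ x) (B∌x : ∀ {z} → B z → z ≢ x) where

      hole∌x : ∀ t → t < m → hole t ≢ x
      hole∌x t t<m with side t t<m
      ... | onQ 0<s s< eq = B∌x (subst B (≡-sym (hole-onQ s< eq)) (interior Q _ 0<s s<))
      ... | onP p with P-position p
      ...   | inj₁ refl = neighbour-≢ x∼a ∘ ≡-trans (≡-sym (≡-trans (hole-onP p) (start P)))
      ...   | inj₂ (inj₁ refl) = neighbour-≢ x∼b ∘ ≡-trans (≡-sym (≡-trans (hole-onP p) (end P)))
      ...   | inj₂ (inj₂ (0<t , t<k₁)) = A∌x (subst A (≡-sym (hole-onP p)) (interior P t 0<t t<k₁))

      wheel : ∀ t → t < m → 0 < t → t ≢ k₁ → E G x (hole t) → Wheel G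
      wheel t t<m 0<t t≢k₁ x∼t = record
        { m = m ; hole = hole ∘ toℕ ; isHole = isHole ; c = x
        ; c∉H = λ i → hole∌x (toℕ i) (Fin.toℕ<n i)
        ; i₁ = fromℕ< 0<m ; i₂ = fromℕ< k₁<m ; i₃ = fromℕ< t<m
        ; distinct = (λ eq → ℕ.<⇒≢ 0<k₁ (Fin.fromℕ<-injective 0 k₁ 0<m k₁<m eq))
                   , (λ eq → ℕ.<⇒≢ 0<t (Fin.fromℕ<-injective 0 t 0<m t<m eq))
                   , (λ eq → t≢k₁ (≡-sym (Fin.fromℕ<-injective k₁ t k₁<m t<m eq)))
        ; adj = at 0<m (subst (E G x) (≡-sym (≡-trans (hole-onP z≤n) (start P))) x∼a)
              , at k₁<m (subst (E G x) (≡-sym (≡-trans (hole-onP ℕ.≤-refl) (end P))) x∼b)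
              , at t<m x∼t }
        where
          at : ∀ {t} (t<m : t < m) → E G x (hole t) → E G x (hole (toℕ (fromℕ< t<m)))
          at {t} t<m = subst (λ i → E G x (hole i)) (≡-sym (Fin.toℕ-fromℕ< t<m))

      wheel-P : ∀ {t} → 0 < t → t < k₁ → E G x (f t) → Wheel G
      wheel-P {t} 0<t t<k₁ x∼ft =
        wheel t (ℕ.<-≤-trans t<k₁ (ℕ.m≤m+n k₁ k₂)) 0<t (ℕ.<⇒≢ t<k₁)
              (subst (E G x) (≡-sym (hole-onP (ℕ.<⇒≤ t<k₁))) x∼ft)

      wheel-Q : ∀ {s} → 0 < s → s < k₂ → E G x (g s) → Wheel G
      wheel-Q {s} 0<s s<k₂ x∼gs =
        wheel (m ∸ s) (ℕ.∸-monoʳ-< 0<s (ℕ.<⇒≤ s<m)) (ℕ.m<n⇒0<n∸m s<m)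
              (ℕ.>⇒≢ (k₁<complement s<k₂ eq)) (subst (E G x) (≡-sym (hole-onQ s<k₂ eq)) x∼gs)
        where
          s<m : s < m
          s<m = ℕ.<-≤-trans s<k₂ (ℕ.m≤n+m k₂ k₁)
          eq : m ∸ s + s ≡ m
          eq = ℕ.m∸n+n≡m (ℕ.<⇒≤ s<m)

  NonNeighbourIn : (Fin n → Set) → Fin n → Fin n → Set
  NonNeighbourIn A x z = A z × ¬ E G x z

  separated-from-centre : ∀ {A x} → (∀ {z} → A z → z ≢ x) → Separated (NonNeighbourIn A x) (_≡ x)
  separated-from-centre A∌x (Az , x≁z) refl = A∌x Az , x≁z ∘ sym G

  interior-neighbour? : ∀ x {C a b} (W : Walk C a b) →
                        Dec (∃ λ t → t < len W × 0 < t × E G x (vertex W t))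
  interior-neighbour? x W = ℕ.anyUpTo? (λ t → (0 ℕ.<? t) ×-dec dec G x (vertex W t)) (len W)

  theta-or-wheel : ∀ {A B a b x} → a ≢ b → ¬ E G a b → E G x a → E G x b →
                   Separated A B → (∀ {z} → A z → z ≢ x) → (∀ {z} → B z → z ≢ x) →
                   Walk A a b → Walk B a b → Theta G ⊎ Wheel G
  theta-or-wheel {A} {B} {a} {b} {x} a≢b a≁b x∼a x∼b sep A∌x B∌x P₀ Q₀
    with chordless P₀ | chordless Q₀
  ... | P , chP | Q , chQ with interior-neighbour? x P | interior-neighbour? x Q
  ... | yes (t , t< , 0<t , x∼t) | _ = inj₂ (Centre.wheel-P x∼a x∼b A∌x B∌x 0<t t< x∼t)
    where open Hole P Q chP chQ sep a≢b a≁b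
  ... | no _ | yes (s , s< , 0<s , x∼s) = inj₂ (Centre.wheel-Q x∼a x∼b A∌x B∌x 0<s s< x∼s)
    where open Hole P Q chP chQ sep a≢b a≁b
  ... | no x≁P | no x≁Q = inj₁ (theta a≢b a≁b P′ Q′ R
                                  (λ (Az , _) (By , _) → sep Az By)
                                  (separated-from-centre A∌x) (separated-from-centre B∌x))
    where
      P′ : Walk (NonNeighbourIn A x) a b
      P′ = restrict-walk P λ t 0<t t< → interior P t 0<t t< , λ x∼t → x≁P (t , t< , 0<t , x∼t)
      Q′ : Walk (NonNeighbourIn B x) a b
      Q′ = restrict-walk Q λ t 0<t t< → interior Q t 0<t t< , λ x∼t → x≁Q (t , t< , 0<t , x∼t)
      R : Walk (_≡ x) a b
      R = cons-walk (sym G x∼a) refl (edge-walk x∼b)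

  Attached : Subset n → Fin n → Fin n → Set
  Attached S u s = s ∈ S × ∃[ w ] (Reach G S u w × E G w s)

  attached? : ∀ S u s → Dec (Attached S u s)
  attached? S u s = (s ∈? S) ×-dec Fin.any? (λ w → Reach? S u w ×-dec dec G w s)

  attachments : Subset n → Fin n → Subset n
  attachments S u = comprehension (attached? S u)

  ∈-attachments⁺ : ∀ {S u s} → Attached S u s → s ∈ attachments S u
  ∈-attachments⁺ {S} {u} = ∈-comprehension⁺ (attached? S u)

  ∈-attachments⁻ : ∀ {S u s} → s ∈ attachments S u → Attached S u s
  ∈-attachments⁻ {S} {u} = ∈-comprehension⁻ (attached? S u)

  attachments⊆ : ∀ {S u} → attachments S u ⊆ S
  attachments⊆ = proj₁ ∘ ∈-attachments⁻

  Reach-confined : ∀ {S u w z} → Reach G S u w → Reach G (attachments S u) w z → Reach G S u z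
  Reach-confined uw here = uw
  Reach-confined {S} uw (step {w = w′} e w′∉ r) with w′ ∈? S
  ... | yes w′∈S = contradiction (∈-attachments⁺ (w′∈S , _ , uw , e)) w′∉
  ... | no w′∉S = Reach-confined (Reach-snoc uw e w′∉S) r

  attachments-separate : ∀ {S u v} → ¬ Reach G S u v → ¬ Reach G (attachments S u) u v
  attachments-separate ¬uv uv = ¬uv (Reach-confined here uv)

  component-walk : ∀ {T u w w′ a b} → Reach G T u w → Reach G T w w′ → E G a w → E G w′ b →
                   Walk (Reach G T u) a b
  component-walk uw here a∼w w∼b = cons-walk a∼w uw (edge-walk w∼b)
  component-walk uw (step e w₁∉ r) a∼w w′∼b =
    cons-walk a∼w uw (component-walk (Reach-snoc uw e w₁∉) r e w′∼b)

  attachment-walk : ∀ {T u a b} → u ∉ T → a ∈ attachments T u → b ∈ attachments T u →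
                    Walk (Reach G T u) a b
  attachment-walk u∉ a∈ b∈ with ∈-attachments⁻ a∈ | ∈-attachments⁻ b∈
  ... | _ , _ , uw , w∼a | _ , _ , uw′ , w′∼b =
    component-walk uw (Reach-trans (Reach-reverse u∉ uw) uw′) (sym G w∼a) w′∼b

  Dominates : Fin n → Subset n → Set
  Dominates x S = ∀ y → y ∈ S → y ≢ x → E G x y

  NonEdgeIn : Subset n → Set
  NonEdgeIn T = ∃[ a ] ∃[ b ] (a ∈ T × b ∈ T × a ≢ b × ¬ E G a b)

  nonEdgeIn? : ∀ T → Dec (NonEdgeIn T)
  nonEdgeIn? T = Fin.any? λ a → Fin.any? λ b →
                 (a ∈? T) ×-dec (b ∈? T) ×-dec ¬? (a Fin.≟ b) ×-dec ¬? (dec G a b)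

  ¬nonEdgeIn⇒clique : ∀ {T} → ¬ NonEdgeIn T → ∀ a b → a ∈ T → b ∈ T → a ≢ b → E G a b
  ¬nonEdgeIn⇒clique ¬ne a b a∈ b∈ a≢b =
    decidable-stable (dec G a b) λ a≁b → ¬ne (a , b , a∈ , b∈ , a≢b , a≁b)

  module Attachments {S x u v} (x∈S : x ∈ S) (x-dominates : Dominates x S) (u∉S : u ∉ S) (v∉S : v ∉ S)
                     (¬uv : ¬ Reach G S u v) (¬vx : ¬ Reach G (attachments S u) v x) where

    T₁ T₂ : Subset n
    T₁ = attachments S u
    T₂ = attachments T₁ v

    T₂⊆S : T₂ ⊆ S
    T₂⊆S = attachments⊆ ∘ attachments⊆

    v∉T₁ : v ∉ T₁
    v∉T₁ = v∉S ∘ attachments⊆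

    ¬uv₁ : ¬ Reach G T₁ u v
    ¬uv₁ = attachments-separate ¬uv

    T₂-cutset : IsCutset G T₂
    T₂-cutset = u , v , u∉S ∘ T₂⊆S , v∉S ∘ T₂⊆S ,
                λ uv → attachments-separate (¬uv₁ ∘ Reach-reverse v∉T₁) (Reach-reverse (u∉S ∘ T₂⊆S) uv)

    components-separated : Separated (Reach G S u) (Reach G T₁ v)
    components-separated {z} {y} uz vy = z≢y , z≁y
      where
        meet : ∀ {w} → Reach G S u w → ¬ Reach G T₁ v w
        meet uw vw = ¬uv₁ (Reach-trans (Reach-antimono attachments⊆ uw) (Reach-reverse v∉T₁ vw))

        z≢y : z ≢ y
        z≢y refl = meet uz vy

        z≁y : ¬ E G z y
        z≁y z∼y with y ∈? S
        ... | yes y∈S = Reach-∉ vy v∉T₁ (∈-attachments⁺ (y∈S , z , uz , z∼y))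
        ... | no y∉S = meet (Reach-snoc uz z∼y y∉S) vy

    nonEdge⇒theta-or-wheel : NonEdgeIn T₂ → Theta G ⊎ Wheel G
    nonEdge⇒theta-or-wheel (a , b , a∈ , b∈ , a≢b , a≁b) =
      theta-or-wheel a≢b a≁b (x-dominates a a∈S a≢x) (x-dominates b b∈S b≢x) components-separated
                     (λ uz → λ { refl → Reach-∉ uz u∉S x∈S }) (λ { vz refl → ¬vx vz })
                     (attachment-walk u∉S (attachments⊆ a∈) (attachments⊆ b∈))
                     (attachment-walk v∉T₁ a∈ b∈)
      where
        a∈S : a ∈ S
        a∈S = T₂⊆S a∈
        b∈S : b ∈ S
        b∈S = T₂⊆S b∈
        a≢x : a ≢ x
        a≢x refl = a≁b (x-dominates b b∈S (a≢b ∘ ≡-sym))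
        b≢x : b ≢ x
        b≢x refl = a≁b (sym G (x-dominates a a∈S a≢b))

    clique-cutset-or-theta-or-wheel : HasCliqueCutset G ⊎ Theta G ⊎ Wheel G
    clique-cutset-or-theta-or-wheel with nonEdgeIn? T₂
    ... | no ¬ne = inj₁ (T₂ , T₂-cutset , ¬nonEdgeIn⇒clique ¬ne)
    ... | yes ne = inj₂ (nonEdge⇒theta-or-wheel ne)

  module Recentre {S x u v} (x∈S : x ∈ S) (x-dominates : Dominates x S) (u∉S : u ∉ S) (v∉S : v ∉ S)
                  (¬uv : ¬ Reach G S u v) (vx : Reach G (attachments S u) v x) where

    T₁ S′ : Subset n
    T₁ = attachments S u
    S′ = T₁ ∪ ⁅ x ⁆

    x∈S′ : x ∈ S′
    x∈S′ = q⊆p∪q T₁ ⁅ x ⁆ (x∈⁅x⁆ x)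

    S′⊆S : S′ ⊆ S
    S′⊆S s∈ with x∈p∪q⁻ T₁ ⁅ x ⁆ s∈
    ... | inj₁ s∈T₁ = attachments⊆ s∈T₁
    ... | inj₂ s∈⁅x⁆ rewrite x∈⁅y⁆⇒x≡y x s∈⁅x⁆ = x∈S

    x-dominates′ : Dominates x S′
    x-dominates′ y y∈ = x-dominates y (S′⊆S y∈)

    u∉S′ : u ∉ S′
    u∉S′ = u∉S ∘ S′⊆S

    v∉S′ : v ∉ S′
    v∉S′ = v∉S ∘ S′⊆S

    ¬vu : ¬ Reach G S′ v u
    ¬vu vu = attachments-separate ¬uv
               (Reach-reverse (v∉S ∘ attachments⊆) (Reach-antimono (p⊆p∪q ⁅ x ⁆) vu))

    -- Otherwise the walk from v to x avoiding T₁ would stay inside the component of v in G ∖ S′.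
    x∈T₁′ : x ∈ attachments S′ v
    x∈T₁′ = decidable-stable (x ∈? attachments S′ v) λ x∉ →
              Reach-∉ (Reach-confined here (Reach-antimono (⊆T₁ x∉) vx)) v∉S′ x∈S′
      where
        ⊆T₁ : x ∉ attachments S′ v → attachments S′ v ⊆ T₁
        ⊆T₁ x∉ s∈ with x∈p∪q⁻ T₁ ⁅ x ⁆ (attachments⊆ s∈)
        ... | inj₁ s∈T₁ = s∈T₁
        ... | inj₂ s∈⁅x⁆ rewrite x∈⁅y⁆⇒x≡y x s∈⁅x⁆ = contradiction s∈ x∉

    ¬ux : ¬ Reach G (attachments S′ v) u x
    ¬ux ux = Reach-∉ ux (u∉S′ ∘ attachments⊆) x∈T₁′

  star-cutset⇒clique-cutset-or-theta-or-wheel : HasStarCutset G → HasCliqueCutset G ⊎ Theta G ⊎ Wheel G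
  star-cutset⇒clique-cutset-or-theta-or-wheel (S , (u , v , u∉S , v∉S , ¬uv) , x , x∈S , x-dominates)
    with Reach? (attachments S u) v x
  ... | no ¬vx = Attachments.clique-cutset-or-theta-or-wheel x∈S x-dominates u∉S v∉S ¬uv ¬vx
  ... | yes vx = Attachments.clique-cutset-or-theta-or-wheel x∈S′ x-dominates′ v∉S′ u∉S′ ¬vu ¬ux
    where open Recentre x∈S x-dominates u∉S v∉S ¬uv vx

lemma3p3 : ∀ {n : ℕ} (G : Graph n) → ¬ Theta G → ¬ Wheel G →
           HasStarCutset G → HasCliqueCutset G
lemma3p3 G ¬theta ¬wheel star =
  [ id , ⊥-elim ∘ [ ¬theta , ¬wheel ]′ ]′ (star-cutset⇒clique-cutset-or-theta-or-wheel G star)
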